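{- There exists a constant $C$ such that for all integers $n\ge 1$ and $d\ge 1$ there is an adjacency labeling scheme for the family $\mathcal{F}(n,d)$ whose label size is at most $\log_2 n + 3\log_2 d + C$ bits.
   Context: A rooted forest is a collection of rooted trees. The depth of a node $u$ in a rooted tree is $1$ plus the hop distance from $u$ to the root (so the root has depth $1$); the depth of a forest is the maximum depth of its nodes. $\mathcal{F}(n,d)$ denotes the family of all rooted forests with at most $n$ nodes and depth at most $d$. An adjacency labeling scheme for a family $\mathcal{G}$ of graphs consists of a marker algorithm that, given any $G\in\mathcal{G}$, assigns a binary string (label) $L(u)$ to each node $u$ of $G$, and a decoder algorithm $\mathcal{D}$, independent of $G$, which given two labels returns a bit, such that for every $G\in\mathcal{G}$ and all nodes $u,v$ of $G$, $\mathcal{D}(L(u),L(v))=1$ if and only if $u$ and $v$ are adjacent in $G$ (for forests, adjacency is in the underlying undirected forest). The label size is the maximum number of bits of a label assigned to any node of any graph in $\mathcal{G}$. -}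

module Defs where

open import Data.Nat using (ℕ; zero; suc; _≤_; _^_; _*_)
open import Data.Fin using (Fin)
open import Data.Maybe using (Maybe; just; nothing)
open import Data.Bool using (Bool; true)
open import Data.List using (List; length)
open import Data.Product using (Σ; _×_; ∃-syntax)
open import Data.Sum using (_⊎_)
open import Function.Bundles using (_⇔_)
open import Relation.Binary.PropositionalEquality using (_≡_)

-- A rooted forest on the node set Fin m is given by its parent map:
-- parent u ≡ nothing  iff  u is a root.
ParentMap : ℕ → Set
ParentMap m = Fin m → Maybe (Fin m)

-- DepthAtMost p k u : the depth of u (1 + hop distance to its root) is at most k.
-- (This also forces the path from u upward to terminate in a root.)
data DepthAtMost {m : ℕ} (p : ParentMap m) : ℕ → Fin m → Set where
  root : ∀ {k u} → p u ≡ nothing → DepthAtMost p (suc k) u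
  step : ∀ {k u v} → p u ≡ just v → DepthAtMost p k v → DepthAtMost p (suc k) u

-- A rooted forest on Fin m of depth at most d: every node has depth ≤ d
-- (in particular the parent map is acyclic, so it is a genuine rooted forest).
record Forest (m d : ℕ) : Set where
  field
    parent  : ParentMap m
    depthOK : ∀ u → DepthAtMost parent d u
open Forest public

Adjacent : ∀ {m d} → Forest m d → Fin m → Fin m → Set
Adjacent F u v = (parent F u ≡ just v) ⊎ (parent F v ≡ just u)

Label : Set
Label = List Bool

LabelingScheme : (n d : ℕ) → (Label → Label → Bool) → (Label → Set) → Set
LabelingScheme n d D sizeOK =
  ∀ (m : ℕ) → m ≤ n → (F : Forest m d) →
    Σ (Fin m → Label) λ L →
      (∀ u → sizeOK (L u)) ×
      (∀ u v → (D (L u) (L v) ≡ true) ⇔ Adjacent F u v)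

module Submission where

open import Defs
open import Data.Nat using (ℕ; _≤_; _^_; _*_; NonZero; >-nonZero)
open import Data.List using (length)
open import Data.Bool using (Bool)
open import Data.Product using (Σ; ∃-syntax; _,_)

-- Each node u receives an interval [pos u, pos u + len u) of natural
-- numbers such that the interval of a child starts inside that of its
-- parent, and distinct nodes of equal depth have disjoint intervals.  Then
-- v is the parent of u iff depth u = 1 + depth v and pos u lies in the
-- interval of v (Layout.below⇒parent), so a label need only describe the
-- depth and the interval of its node.  The intervals are built bottom-up:
-- v gets one unit followed by the slots of its children, and the interval
-- of v is aligned to a multiple of 2 ^ t with 2 ^ t ≈ size v / d.  The
-- alignment costs at most size / d per level, hence at most size over the
-- ≤ d levels: every slot is at most 3 * size (Layout.slot-bound), all
-- intervals lie in [0, 3 n) and len v / 2 ^ t < 6 d.  A label stores the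
-- depth, len / 2 ^ t and pos / 2 ^ t, the last in log₂(3 n) − t bits so that
-- t is recovered from the label length (Scheme.decode-encode).

module FixedWidthCodes where

  open import Data.Nat
  open import Data.Nat.Properties
  open import Data.Nat.DivMod
  open import Data.Bool using (Bool; if_then_else_)
  open import Data.List using (List; []; _∷_; length; _++_)
  open import Data.List.Properties using (++-identityʳ)
  open import Data.Product using (_×_; _,_; proj₁; map₁)
  open import Relation.Binary.PropositionalEquality

  toBits : ℕ → ℕ → List Bool
  toBits zero    x = []
  toBits (suc w) x = (x % 2 ≡ᵇ 1) ∷ toBits w (x / 2)

  bitValue : Bool → ℕ
  bitValue b = if b then 1 else 0

  readBits : ℕ → List Bool → ℕ × List Bool
  readBits zero    bs       = 0 , bs
  readBits (suc w) []       = 0 , []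
  readBits (suc w) (b ∷ bs) = map₁ (λ x → bitValue b + 2 * x) (readBits w bs)

  fromBits : List Bool → ℕ
  fromBits bs = proj₁ (readBits (length bs) bs)

  length-toBits : ∀ w x → length (toBits w x) ≡ w
  length-toBits zero    x = refl
  length-toBits (suc w) x = cong suc (length-toBits w (x / 2))

  bitValue-parity : ∀ x → bitValue (x % 2 ≡ᵇ 1) ≡ x % 2
  bitValue-parity x with x % 2 | m%n<n x 2
  ... | 0 | _ = refl
  ... | 1 | _ = refl
  ... | suc (suc _) | s≤s (s≤s ())

  readBits-toBits : ∀ w x rest → x < 2 ^ w → readBits w (toBits w x ++ rest) ≡ (x , rest)
  readBits-toBits zero    zero    rest _         = refl
  readBits-toBits zero    (suc x) rest (s≤s ())
  readBits-toBits (suc w) x    rest x<2^[1+w] = begin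
    map₁ (λ y → lowBit + 2 * y) (readBits w (toBits w (x / 2) ++ rest))
      ≡⟨ cong (map₁ (λ y → lowBit + 2 * y)) (readBits-toBits w (x / 2) rest half<) ⟩
    (lowBit + 2 * (x / 2) , rest)
      ≡⟨ cong (_, rest) (cong₂ _+_ (bitValue-parity x) (*-comm 2 (x / 2))) ⟩
    (x % 2 + x / 2 * 2 , rest)
      ≡⟨ cong (_, rest) (m≡m%n+[m/n]*n x 2) ⟨
    (x , rest) ∎
    where
    open ≡-Reasoning
    lowBit : ℕ
    lowBit = bitValue (x % 2 ≡ᵇ 1)
    half< : x / 2 < 2 ^ w
    half< = m<n*o⇒m/o<n (subst (x <_) (*-comm 2 (2 ^ w)) x<2^[1+w])

  fromBits-toBits : ∀ w x → x < 2 ^ w → fromBits (toBits w x) ≡ x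
  fromBits-toBits w x x< = begin
    proj₁ (readBits (length (toBits w x)) (toBits w x))  ≡⟨ cong (λ k → proj₁ (readBits k (toBits w x))) (length-toBits w x) ⟩
    proj₁ (readBits w (toBits w x))                      ≡⟨ cong (λ bs → proj₁ (readBits w bs)) (++-identityʳ (toBits w x)) ⟨
    proj₁ (readBits w (toBits w x ++ []))                ≡⟨ cong proj₁ (readBits-toBits w x [] x<) ⟩
    x                                                    ∎
    where open ≡-Reasoning

module PowersOfTwo where

  open import Data.Nat
  open import Data.Nat.Properties
  open import Data.Nat.DivMod using (_/_; _%_; m≡m%n+[m/n]*n; m%n<n; m/n*n≤m)
  open import Data.Product using (Σ; _×_; _,_; proj₁; proj₂)
  open import Data.Empty using (⊥-elim)
  open import Relation.Binary.PropositionalEquality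
  open import Relation.Nullary using (yes; no)

  2^t≢0 : ∀ t → NonZero (2 ^ t)
  2^t≢0 t = m^n≢0 2 t

  <[1+/]* : ∀ x k .{{_ : NonZero k}} → x < suc (x / k) * k
  <[1+/]* x k = begin-strict
    x                 ≡⟨ m≡m%n+[m/n]*n x k ⟩
    x % k + x / k * k <⟨ +-monoˡ-< (x / k * k) (m%n<n x k) ⟩
    k + x / k * k     ∎
    where open ≤-Reasoning

  ⌈_/2^_⌉ : ℕ → ℕ → ℕ
  ⌈ x /2^ t ⌉ = _/_ (x + (2 ^ t ∸ 1)) (2 ^ t) {{2^t≢0 t}}

  ⌈/2^⌉-lower : ∀ x t → x ≤ ⌈ x /2^ t ⌉ * 2 ^ t
  ⌈/2^⌉-lower x t = ≤-pred (+-cancelʳ-< (k ∸ 1) x (suc (q * k)) (begin-strict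
    x + (k ∸ 1)           <⟨ <[1+/]* (x + (k ∸ 1)) k {{2^t≢0 t}} ⟩
    k + q * k             ≡⟨ cong (_+ q * k) (m+[n∸m]≡n (m^n>0 2 t)) ⟨
    suc (k ∸ 1) + q * k   ≡⟨ cong suc (+-comm (k ∸ 1) (q * k)) ⟩
    suc (q * k) + (k ∸ 1) ∎))
    where
    open ≤-Reasoning
    k q : ℕ
    k = 2 ^ t
    q = ⌈ x /2^ t ⌉

  ⌈/2^⌉-upper : ∀ x t → ⌈ x /2^ t ⌉ * 2 ^ t ≤ x + (2 ^ t ∸ 1)
  ⌈/2^⌉-upper x t = m/n*n≤m (x + (2 ^ t ∸ 1)) (2 ^ t) {{2^t≢0 t}}

  n<2^n : ∀ n → n < 2 ^ n
  n<2^n zero    = z<s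
  n<2^n (suc n) = +-mono-≤ (m^n>0 2 n) (≤-trans (n<2^n n) (m≤m+n (2 ^ n) 0))

  searchLog : ∀ k x → 1 ≤ x → x < 2 ^ k → Σ ℕ λ t → 2 ^ t ≤ x × x < 2 ^ suc t
  searchLog zero    (suc x) _   (s≤s ())
  searchLog (suc k) x       1≤x x<2^[1+k] with x <? 2 ^ k
  ... | yes x<2^k = searchLog k x 1≤x x<2^k
  ... | no  x≮2^k = k , ≮⇒≥ x≮2^k , x<2^[1+k]

  logOfSuc : ∀ x → Σ ℕ λ t → 2 ^ t ≤ suc x × suc x < 2 ^ suc t
  logOfSuc x = searchLog (suc x) (suc x) (s≤s z≤n) (n<2^n (suc x))

  -- lg x = ⌊log₂ x⌋, with lg 0 = 0.
  lg : ℕ → ℕ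
  lg zero    = 0
  lg (suc x) = proj₁ (logOfSuc x)

  2^lg≤ : ∀ x → 1 ≤ x → 2 ^ lg x ≤ x
  2^lg≤ (suc x) _ = proj₁ (proj₂ (logOfSuc x))

  <2^[1+lg] : ∀ x → x < 2 ^ suc (lg x)
  <2^[1+lg] zero    = s≤s z≤n
  <2^[1+lg] (suc x) = proj₂ (proj₂ (logOfSuc x))

  2^[1+lg]≤2* : ∀ x → 1 ≤ x → 2 ^ suc (lg x) ≤ 2 * x
  2^[1+lg]≤2* x 1≤x = *-monoʳ-≤ 2 (2^lg≤ x 1≤x)

  2^-cancel-< : ∀ {a b} → 2 ^ a < 2 ^ b → a < b
  2^-cancel-< {a} {b} 2^a<2^b with a <? b
  ... | yes a<b = a<b
  ... | no  a≮b = ⊥-elim (<⇒≱ 2^a<2^b (^-monoʳ-≤ 2 (≮⇒≥ a≮b)))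

module GuardedSums where

  open import Data.Nat hiding (_≟_)
  open import Data.Nat.Properties hiding (suc-injective; _≟_)
  open import Data.Fin using (Fin; zero; suc; _≟_)
  open import Data.Fin.Properties using (suc-injective)
  open import Data.Empty using (⊥-elim)
  open import Relation.Binary.PropositionalEquality
  open import Relation.Nullary using (Dec; yes; no; ¬_)
  open import Function using (_∘_)
  open import Algebra.Properties.Semiring.Sum +-*-semiring public
    using (sum; sum-cong-≗; ∑-distrib-+; ∑-comm; *-distribˡ-sum)

  private
    variable
      A B : Set
      n : ℕ

  when : Dec A → ℕ → ℕ
  when (yes _) x = x
  when (no _)  _ = 0

  when-yes : (A? : Dec A) → A → ∀ x → when A? x ≡ x
  when-yes (yes _) _ x = refl
  when-yes (no ¬a) a x = ⊥-elim (¬a a)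

  when-no : (A? : Dec A) → ¬ A → ∀ x → when A? x ≡ 0
  when-no (yes a) ¬a x = ⊥-elim (¬a a)
  when-no (no _)  _  x = refl

  when-cong : (A? : Dec A) {x y : ℕ} → (A → x ≡ y) → when A? x ≡ when A? y
  when-cong (yes a) x≡y = x≡y a
  when-cong (no _)  _   = refl

  when-mono : (A? : Dec A) {x y : ℕ} → (A → x ≤ y) → when A? x ≤ when A? y
  when-mono (yes a) x≤y = x≤y a
  when-mono (no _)  _   = z≤n

  when-weaken : (A? : Dec A) (B? : Dec B) {x : ℕ} → (A → B) → when A? x ≤ when B? x
  when-weaken (yes a) B? A⇒B = ≤-reflexive (sym (when-yes B? (A⇒B a) _))
  when-weaken (no _)  B? A⇒B = z≤n

  *-when : (A? : Dec A) → ∀ k x → k * when A? x ≡ when A? (k * x)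
  *-when (yes _) k x = refl
  *-when (no _)  k x = *-zeroʳ k

  sum-mono : {f g : Fin n → ℕ} → (∀ i → f i ≤ g i) → sum f ≤ sum g
  sum-mono {zero}  f≤g = z≤n
  sum-mono {suc n} f≤g = +-mono-≤ (f≤g zero) (sum-mono (λ i → f≤g (suc i)))

  sum-ones : sum {n} (λ _ → 1) ≡ n
  sum-ones {zero}  = refl
  sum-ones {suc n} = cong suc (sum-ones {n})

  sum-zero : (f : Fin n → ℕ) → (∀ i → f i ≡ 0) → sum f ≡ 0
  sum-zero {zero}  f f≡0 = refl
  sum-zero {suc n} f f≡0 = cong₂ _+_ (f≡0 zero) (sum-zero (λ i → f (suc i)) (λ i → f≡0 (suc i)))

  sum-single : (f : Fin n → ℕ) (j : Fin n) → (∀ i → i ≢ j → f i ≡ 0) → sum f ≡ f j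
  sum-single {suc n} f zero    f≡0 = begin
    f zero + sum (λ i → f (suc i)) ≡⟨ cong (f zero +_) (sum-zero (λ i → f (suc i)) (λ i → f≡0 (suc i) λ ())) ⟩
    f zero + 0                     ≡⟨ +-identityʳ (f zero) ⟩
    f zero                         ∎
    where open ≡-Reasoning
  sum-single {suc n} f (suc j) f≡0 = begin
    f zero + sum (λ i → f (suc i)) ≡⟨ cong (_+ sum (λ i → f (suc i))) (f≡0 zero λ ()) ⟩
    sum (λ i → f (suc i))          ≡⟨ sum-single (λ i → f (suc i)) j (λ i i≢j → f≡0 (suc i) (i≢j ∘ suc-injective)) ⟩
    f (suc j)                      ∎
    where open ≡-Reasoning

  sum-insert : {P Q : Fin n → Set} (P? : ∀ i → Dec (P i)) (Q? : ∀ i → Dec (Q i))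
               (f : Fin n → ℕ) (j : Fin n) → ¬ P j → Q j → (∀ i → P i → Q i) →
               sum (λ i → when (P? i) (f i)) + f j ≤ sum (λ i → when (Q? i) (f i))
  sum-insert P? Q? f j ¬Pj Qj P⇒Q = begin
    sum (λ i → when (P? i) (f i)) + f j
      ≡⟨ cong (sum (λ i → when (P? i) (f i)) +_) only-j ⟨
    sum (λ i → when (P? i) (f i)) + sum (λ i → when (i ≟ j) (f i))
      ≡⟨ ∑-distrib-+ (λ i → when (P? i) (f i)) (λ i → when (i ≟ j) (f i)) ⟨
    sum (λ i → when (P? i) (f i) + when (i ≟ j) (f i))
      ≤⟨ sum-mono pointwise ⟩
    sum (λ i → when (Q? i) (f i)) ∎
    where
    open ≤-Reasoning
    only-j : sum (λ i → when (i ≟ j) (f i)) ≡ f j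
    only-j = trans (sum-single _ j (λ i i≢j → when-no (i ≟ j) i≢j (f i))) (when-yes (j ≟ j) refl (f j))
    pointwise : ∀ i → when (P? i) (f i) + when (i ≟ j) (f i) ≤ when (Q? i) (f i)
    pointwise i with i ≟ j
    ... | yes refl = ≤-reflexive (trans (cong (_+ f i) (when-no (P? i) ¬Pj (f i))) (sym (when-yes (Q? i) Qj (f i))))
    ... | no _     = ≤-trans (≤-reflexive (+-identityʳ _)) (when-weaken (P? i) (Q? i) (P⇒Q i))

module RootPaths {m : ℕ} (par : ParentMap m) where

  open import Data.Nat using (ℕ)
  open import Data.Fin using (Fin)
  open import Data.Maybe.Properties using (just-injective)
  open import Relation.Binary.PropositionalEquality

  module _ (atRoot : Fin m → ℕ) (atChild : Fin m → Fin m → ℕ → ℕ) where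

    foldPath : ∀ {k u} → DepthAtMost par k u → ℕ
    foldPath {u = u} (root _)                = atRoot u
    foldPath {u = u} (step {v = v} _ toRoot) = atChild u v (foldPath toRoot)

    -- The path to the root is determined by par, so the value does not
    -- depend on which depth bound the derivation certifies.
    foldPath-irrelevant : ∀ {k k′ u} (a : DepthAtMost par k u) (b : DepthAtMost par k′ u) →
                          foldPath a ≡ foldPath b
    foldPath-irrelevant (root _)   (root _)     = refl
    foldPath-irrelevant (root u↑)  (step u↑′ _) with () ← trans (sym u↑) u↑′
    foldPath-irrelevant (step u↑ _) (root u↑′)  with () ← trans (sym u↑) u↑′
    foldPath-irrelevant {u = u} (step u↑ a) (step u↑′ b)
      with refl ← just-injective (trans (sym u↑) u↑′) = cong (atChild u _) (foldPath-irrelevant a b)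

module Intervals where

  open import Data.Nat using (ℕ; suc; _+_; _≤_; _<_; _≟_; _≤?_; _<?_)
  open import Data.Product using (_×_; _,_)
  open import Relation.Binary.PropositionalEquality using (_≡_)
  open import Relation.Nullary using (Dec)
  open import Relation.Nullary.Decidable using (_×-dec_)

  -- What a label reveals about a node: its depth and its interval
  -- [pos, pos + len), as the triple (depth , pos , len).
  NodeInfo : Set
  NodeInfo = ℕ × ℕ × ℕ

  Below : NodeInfo → NodeInfo → Set
  Below (δ , p , _) (δ′ , p′ , l′) = δ ≡ suc δ′ × p′ ≤ p × p < p′ + l′

  below? : ∀ a b → Dec (Below a b)
  below? (δ , p , _) (δ′ , p′ , l′) = (δ ≟ suc δ′) ×-dec (p′ ≤? p) ×-dec (p <? p′ + l′)

module Subtrees {m d : ℕ} (F : Forest m d) where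

  open import Data.Nat hiding (_≟_)
  open import Data.Nat.Properties hiding (_≟_)
  open import Data.Fin using (Fin; _≟_)
  open import Data.Maybe using (Maybe; just; nothing)
  open import Data.Maybe.Properties using (just-injective; ≡-dec)
  open import Relation.Binary.PropositionalEquality
  open import Relation.Nullary using (Dec)
  open GuardedSums
  open RootPaths (parent F)

  par : ParentMap m
  par = parent F

  along : (Fin m → ℕ) → (Fin m → Fin m → ℕ → ℕ) → Fin m → ℕ
  along atRoot atChild u = foldPath atRoot atChild (depthOK F u)

  along-root : ∀ {r s u} → par u ≡ nothing → along r s u ≡ r u
  along-root {r} {s} {u} u↑ = foldPath-irrelevant r s (depthOK F u) (root {k = d} u↑)

  along-step : ∀ {r s u v} → par u ≡ just v → along r s u ≡ s u v (along r s v)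
  along-step {r} {s} {u} u↑ = foldPath-irrelevant r s (depthOK F u) (step {k = d} u↑ (depthOK F _))

  depth : Fin m → ℕ
  depth = along (λ _ → 1) (λ _ _ → suc)

  depth-root : ∀ {u} → par u ≡ nothing → depth u ≡ 1
  depth-root = along-root

  depth-child : ∀ {u v} → par u ≡ just v → depth u ≡ suc (depth v)
  depth-child = along-step

  depth-pos : ∀ u → 1 ≤ depth u
  depth-pos u with par u in u↑
  ... | nothing = ≤-reflexive (sym (depth-root u↑))
  ... | just _  = ≤-trans (s≤s z≤n) (≤-reflexive (sym (depth-child u↑)))

  depth-≤ : ∀ u → depth u ≤ d
  depth-≤ u = pathLength≤ (depthOK F u)
    where
    pathLength≤ : ∀ {k u} (toRoot : DepthAtMost par k u) → foldPath (λ _ → 1) (λ _ _ → suc) toRoot ≤ k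
    pathLength≤ (root _)        = s≤s z≤n
    pathLength≤ (step _ toRoot) = s≤s (pathLength≤ toRoot)

  depth≢0 : ∀ v → depth v ≢ 0
  depth≢0 v dv≡0 = <⇒≱ (depth-pos v) (≤-reflexive dv≡0)

  root-shallower : ∀ {w u u′} → par w ≡ nothing → par u ≡ just u′ → depth w ≢ depth u
  root-shallower {u′ = u′} w↑ u↑ dw≡du =
    depth≢0 u′ (suc-injective (trans (sym (depth-child u↑)) (trans (sym dw≡du) (depth-root w↑))))

  -- The remaining height budget d ∸ depth v bounds the height of the subtree
  -- of v; it drives the bottom-up recursions below.
  budget : Fin m → ℕ
  budget v = d ∸ depth v

  budget-child : ∀ {c v k} → par c ≡ just v → budget v ≡ suc k → budget c ≡ k
  budget-child {c} {v} {k} c↑ b≡ = begin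
    d ∸ depth c         ≡⟨ cong (d ∸_) (depth-child c↑) ⟩
    d ∸ suc (depth v)   ≡⟨ pred[m∸n]≡m∸[1+n] d (depth v) ⟨
    pred (d ∸ depth v)  ≡⟨ cong pred b≡ ⟩
    k                   ∎
    where open ≡-Reasoning

  budget-exhausted : ∀ {c v} → par c ≡ just v → budget v ≢ 0
  budget-exhausted {c} {v} c↑ b≡0 = <-irrefl refl (begin-strict
    d              ≡⟨ ≤-antisym (m∸n≡0⇒m≤n b≡0) (depth-≤ v) ⟩
    depth v        <⟨ n<1+n (depth v) ⟩
    suc (depth v)  ≡⟨ depth-child c↑ ⟨
    depth c        ≤⟨ depth-≤ c ⟩
    d              ∎)
    where open ≤-Reasoning

  _≟ᴹ_ : (x y : Maybe (Fin m)) → Dec (x ≡ y)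
  _≟ᴹ_ = ≡-dec _≟_

  -- The sum of g over the nodes whose parent is x (x = nothing: the roots).
  sumUnder : Maybe (Fin m) → (Fin m → ℕ) → ℕ
  sumUnder x g = sum (λ c → when (par c ≟ᴹ x) (g c))

  childSum : Fin m → (Fin m → ℕ) → ℕ
  childSum v = sumUnder (just v)

  childSum-cong : ∀ v {g h} → (∀ c → par c ≡ just v → g c ≡ h c) → childSum v g ≡ childSum v h
  childSum-cong v g≡h = sum-cong-≗ λ c → when-cong (par c ≟ᴹ just v) (g≡h c)

  sumUnder-mono : ∀ x {g h} → (∀ c → par c ≡ x → g c ≤ h c) → sumUnder x g ≤ sumUnder x h
  sumUnder-mono x g≤h = sum-mono λ c → when-mono (par c ≟ᴹ x) (g≤h c)

  *-sumUnder : ∀ k x g → k * sumUnder x g ≡ sumUnder x (λ c → k * g c)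
  *-sumUnder k x g = trans (*-distribˡ-sum k (λ c → when (par c ≟ᴹ x) (g c)))
                           (sum-cong-≗ λ c → *-when (par c ≟ᴹ x) k (g c))

  childSum-leaf : ∀ v g → budget v ≡ 0 → childSum v g ≡ 0
  childSum-leaf v g b≡0 = sum-zero _ λ c → when-no (par c ≟ᴹ just v) (λ c↑ → budget-exhausted c↑ b≡0) (g c)

  -- Every node is counted exactly once: among the roots or under its parent.
  sum-by-parent : ∀ g → sum g ≡ sumUnder nothing g + sum (λ v → childSum v g)
  sum-by-parent g = begin
    sum g
      ≡⟨ sum-cong-≗ split ⟩
    sum (λ c → when (par c ≟ᴹ nothing) (g c) + sum (λ v → when (par c ≟ᴹ just v) (g c)))
      ≡⟨ ∑-distrib-+ (λ c → when (par c ≟ᴹ nothing) (g c)) (λ c → sum (λ v → when (par c ≟ᴹ just v) (g c))) ⟩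
    sumUnder nothing g + sum (λ c → sum (λ v → when (par c ≟ᴹ just v) (g c)))
      ≡⟨ cong (sumUnder nothing g +_) (∑-comm (λ c v → when (par c ≟ᴹ just v) (g c))) ⟩
    sumUnder nothing g + sum (λ v → childSum v g) ∎
    where
    open ≡-Reasoning
    split : ∀ c → g c ≡ when (par c ≟ᴹ nothing) (g c) + sum (λ v → when (par c ≟ᴹ just v) (g c))
    split c with par c in c↑
    ... | nothing = sym (trans (cong (g c +_) (sum-zero _ λ v → when-no (nothing ≟ᴹ just v) (λ ()) (g c)))
                               (+-identityʳ (g c)))
    ... | just w  = sym (trans (sum-single _ w λ v v≢w →
                                  when-no (just w ≟ᴹ just v) (λ e → v≢w (sym (just-injective e))) (g c))
                               (when-yes (just w ≟ᴹ just w) refl (g c)))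

  -- Bottom-up recursion: the value at v is computed by combine from the sum
  -- of the values at the children of v; the height budget is the fuel.
  module BottomUp (combine : Fin m → ℕ → ℕ) where

    private
      valueWith : ℕ → Fin m → ℕ
      valueWith zero    v = combine v 0
      valueWith (suc k) v = combine v (childSum v (valueWith k))

    value : Fin m → ℕ
    value v = valueWith (budget v) v

    value-eq : ∀ v → value v ≡ combine v (childSum v value)
    value-eq v = unfold (budget v) refl
      where
      unfold : ∀ k → budget v ≡ k → valueWith k v ≡ combine v (childSum v value)
      unfold zero    b≡0 = cong (combine v) (sym (childSum-leaf v value b≡0))
      unfold (suc k) b≡  = cong (combine v) (childSum-cong v λ c c↑ →
                             cong (λ j → valueWith j c) (sym (budget-child c↑ b≡)))

  size : Fin m → ℕ
  size = BottomUp.value (λ _ s → suc s)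

  size-eq : ∀ v → size v ≡ suc (childSum v size)
  size-eq = BottomUp.value-eq (λ _ s → suc s)

  roots-cover : sumUnder nothing size ≡ m
  roots-cover = +-cancelʳ-≡ Σchildren _ _ (begin
    sumUnder nothing size + Σchildren ≡⟨ sum-by-parent size ⟨
    sum size                          ≡⟨ sum-cong-≗ size-eq ⟩
    sum (λ v → 1 + childSum v size)   ≡⟨ ∑-distrib-+ {m} (λ _ → 1) (λ v → childSum v size) ⟩
    sum {m} (λ _ → 1) + Σchildren     ≡⟨ cong (_+ Σchildren) sum-ones ⟩
    m + Σchildren                     ∎)
    where
    open ≡-Reasoning
    Σchildren : ℕ
    Σchildren = sum (λ v → childSum v size)

module Layout {m d : ℕ} .{{_ : NonZero d}} (F : Forest m d) where

  open import Data.Nat hiding (_≟_)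
  open import Data.Nat.Properties hiding (_≟_)
  open import Data.Nat.DivMod using (_/_; m/n*n≤m)
  open import Data.Fin using (Fin) renaming (_<_ to _<ᶠ_; _<?_ to _<ᶠ?_)
  open import Data.Fin.Properties using (_≟_)
    renaming (<-irrefl to <ᶠ-irrefl; <-trans to <ᶠ-trans; <-cmp to <ᶠ-cmp)
  open import Data.Maybe using (Maybe; just; nothing)
  open import Data.Product using (_×_; _,_; proj₁; proj₂)
  open import Data.Sum using (_⊎_; inj₁; inj₂)
  open import Data.Empty using (⊥-elim)
  open import Relation.Binary.PropositionalEquality
  open import Relation.Binary.Definitions using (tri<; tri≈; tri>)
  open import Relation.Nullary using (Dec; yes; no; ¬_)
  open import Relation.Nullary.Decidable using (_×-dec_)
  open import Data.Nat.Tactic.RingSolver using (solve-∀)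
  open PowersOfTwo
  open GuardedSums
  open Intervals
  open Subtrees F public

  -- Intervals of a subtree are aligned to multiples of 2 ^ align v, chosen
  -- so that 2 ^ align v ≈ size v / d: the alignment slack is then paid for
  -- by a 1/d share of the subtree at each of the ≤ d levels.
  align : Fin m → ℕ
  align v = lg (size v / d)

  slack : Fin m → ℕ
  slack v = 2 ^ align v ∸ 1

  slack-bound : ∀ v → d * slack v ≤ size v
  slack-bound v with size v / d in q≡
  ... | zero  = ≤-trans (≤-reflexive (*-zeroʳ d)) z≤n
  ... | suc q = begin
    d * (2 ^ lg (suc q) ∸ 1) ≤⟨ *-monoʳ-≤ d (m∸n≤m _ 1) ⟩
    d * 2 ^ lg (suc q)       ≤⟨ *-monoʳ-≤ d (2^lg≤ (suc q) (s≤s z≤n)) ⟩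
    d * suc q                ≡⟨ *-comm d (suc q) ⟩
    suc q * d                ≡⟨ cong (_* d) q≡ ⟨
    size v / d * d           ≤⟨ m/n*n≤m (size v) d ⟩
    size v                   ∎
    where open ≤-Reasoning

  size-bound : ∀ v → size v < 2 ^ suc (align v) * d
  size-bound v = begin-strict
    size v                  <⟨ <[1+/]* (size v) d ⟩
    suc (size v / d) * d    ≤⟨ *-monoˡ-≤ d (<2^[1+lg] (size v / d)) ⟩
    2 ^ suc (align v) * d   ∎
    where open ≤-Reasoning

  -- The interval of v has length len v = width v * 2 ^ align v and holds one
  -- unit for v itself followed by the slots of its children; a slot adds the
  -- room needed to realign an interval inside its parent's interval.
  slot : Fin m → ℕ
  slot = BottomUp.value (λ v s → ⌈ suc s /2^ align v ⌉ * 2 ^ align v + slack v)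

  width : Fin m → ℕ
  width v = ⌈ suc (childSum v slot) /2^ align v ⌉

  len : Fin m → ℕ
  len v = width v * 2 ^ align v

  slot-eq : ∀ v → slot v ≡ len v + slack v
  slot-eq = BottomUp.value-eq (λ v s → ⌈ suc s /2^ align v ⌉ * 2 ^ align v + slack v)

  len-lower : ∀ v → suc (childSum v slot) ≤ len v
  len-lower v = ⌈/2^⌉-lower (suc (childSum v slot)) (align v)

  len-upper : ∀ v → len v ≤ suc (childSum v slot) + slack v
  len-upper v = ⌈/2^⌉-upper (suc (childSum v slot)) (align v)

  2^align≤len : ∀ v → 2 ^ align v ≤ len v
  2^align≤len v = m≤n*m (2 ^ align v) (width v) {{width≢0}}
    where
    width≢0 : NonZero (width v)
    width≢0 = ≢-nonZero λ w≡0 → <⇒≱ (≤-trans (s≤s z≤n) (len-lower v)) (≤-reflexive (cong (_* 2 ^ align v) w≡0))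

  -- Siblings are laid out one after another in the order of their indices.
  SiblingBefore : Fin m → Fin m → Set
  SiblingBefore w u = par w ≡ par u × w <ᶠ u

  siblingBefore? : ∀ w u → Dec (SiblingBefore w u)
  siblingBefore? w u = (par w ≟ᴹ par u) ×-dec (w <ᶠ? u)

  before : Fin m → ℕ
  before u = sum (λ w → when (siblingBefore? w u) (slot w))

  -- u starts at pos u = index u * 2 ^ align u, the first multiple of
  -- 2 ^ align u at or after offset u = (pos of its parent) + before u.
  index : Fin m → ℕ
  index = along (λ u → ⌈ before u /2^ align u ⌉)
                (λ u v i → ⌈ i * 2 ^ align v + before u /2^ align u ⌉)

  pos : Fin m → ℕ
  pos u = index u * 2 ^ align u

  parentPos : Maybe (Fin m) → ℕ
  parentPos nothing  = 0
  parentPos (just v) = pos v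

  offset : Fin m → ℕ
  offset u = parentPos (par u) + before u

  index-eq : ∀ u → index u ≡ ⌈ offset u /2^ align u ⌉
  index-eq u = by-parent (par u) refl
    where
    by-parent : ∀ x → par u ≡ x → index u ≡ ⌈ parentPos x + before u /2^ align u ⌉
    by-parent nothing  u↑ = along-root u↑
    by-parent (just _) u↑ = along-step u↑

  pos-lower : ∀ u → offset u ≤ pos u
  pos-lower u = ≤-trans (⌈/2^⌉-lower (offset u) (align u)) (≤-reflexive (cong (_* 2 ^ align u) (sym (index-eq u))))

  end-in-slot : ∀ u → pos u + len u ≤ offset u + slot u
  end-in-slot u = begin
    index u * 2 ^ align u + len u
      ≡⟨ cong (λ i → i * 2 ^ align u + len u) (index-eq u) ⟩
    ⌈ offset u /2^ align u ⌉ * 2 ^ align u + len u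
      ≤⟨ +-monoˡ-≤ (len u) (⌈/2^⌉-upper (offset u) (align u)) ⟩
    offset u + slack u + len u
      ≡⟨ +-assoc (offset u) (slack u) (len u) ⟩
    offset u + (slack u + len u)
      ≡⟨ cong (offset u +_) (trans (+-comm (slack u) (len u)) (sym (slot-eq u))) ⟩
    offset u + slot u ∎
    where open ≤-Reasoning

  before-slot : ∀ u → before u + slot u ≤ sumUnder (par u) slot
  before-slot u = sum-insert (λ w → siblingBefore? w u) (λ w → par w ≟ᴹ par u) slot u
                             (λ (_ , u<u) → <ᶠ-irrefl refl u<u) refl (λ _ → proj₁)

  before-mono : ∀ {w u} → par w ≡ par u → w <ᶠ u → before w + slot w ≤ before u
  before-mono {w} {u} w↑≡u↑ w<u =
    sum-insert (λ i → siblingBefore? i w) (λ i → siblingBefore? i u) slot w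
               (λ (_ , w<w) → <ᶠ-irrefl refl w<w) (w↑≡u↑ , w<u)
               (λ i (i↑≡w↑ , i<w) → trans i↑≡w↑ w↑≡u↑ , <ᶠ-trans i<w w<u)

  end-in-parent : ∀ u → pos u + len u ≤ parentPos (par u) + sumUnder (par u) slot
  end-in-parent u = begin
    pos u + len u                               ≤⟨ end-in-slot u ⟩
    parentPos (par u) + before u + slot u       ≡⟨ +-assoc (parentPos (par u)) (before u) (slot u) ⟩
    parentPos (par u) + (before u + slot u)     ≤⟨ +-monoʳ-≤ (parentPos (par u)) (before-slot u) ⟩
    parentPos (par u) + sumUnder (par u) slot   ∎
    where open ≤-Reasoning

  total : ℕ
  total = sumUnder nothing slot

  child-pos : ∀ {u v} → par u ≡ just v → pos v ≤ pos u
  child-pos {u} u↑ = ≤-trans (≤-trans (≤-reflexive (cong parentPos (sym u↑))) (m≤m+n _ (before u))) (pos-lower u)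

  child-end : ∀ {u v} → par u ≡ just v → pos u + len u < pos v + len v
  child-end {u} {v} u↑ = begin-strict
    pos u + len u                               ≤⟨ end-in-parent u ⟩
    parentPos (par u) + sumUnder (par u) slot   ≡⟨ cong (λ x → parentPos x + sumUnder x slot) u↑ ⟩
    pos v + childSum v slot                     <⟨ +-monoʳ-< (pos v) (len-lower v) ⟩
    pos v + len v                               ∎
    where open ≤-Reasoning

  root-end : ∀ {u} → par u ≡ nothing → pos u + len u ≤ total
  root-end {u} u↑ = ≤-trans (end-in-parent u) (≤-reflexive (cong (λ x → parentPos x + sumUnder x slot) u↑))

  end≤total : ∀ u → pos u + len u ≤ total
  end≤total u = along-path (depthOK F u)
    where
    along-path : ∀ {k u} → DepthAtMost par k u → pos u + len u ≤ total
    along-path (root u↑)        = root-end u↑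
    along-path (step u↑ toRoot) = ≤-trans (<⇒≤ (child-end u↑)) (along-path toRoot)

  siblings-apart : ∀ {w u} → par w ≡ par u → w <ᶠ u → pos w + len w ≤ pos u
  siblings-apart {w} {u} w↑≡u↑ w<u = begin
    pos w + len w                           ≤⟨ end-in-slot w ⟩
    parentPos (par w) + before w + slot w   ≡⟨ +-assoc (parentPos (par w)) (before w) (slot w) ⟩
    parentPos (par w) + (before w + slot w) ≤⟨ +-monoʳ-≤ (parentPos (par w)) (before-mono w↑≡u↑ w<u) ⟩
    parentPos (par w) + before u            ≡⟨ cong (λ x → parentPos x + before u) w↑≡u↑ ⟩
    offset u                                ≤⟨ pos-lower u ⟩
    pos u                                   ∎
    where open ≤-Reasoning

  Apart : Fin m → Fin m → Set
  Apart w u = pos w + len w ≤ pos u ⊎ pos u + len u ≤ pos w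

  siblings-disjoint : ∀ {w u} → par w ≡ par u → w ≢ u → Apart w u
  siblings-disjoint {w} {u} w↑≡u↑ w≢u with <ᶠ-cmp w u
  ... | tri< w<u _ _ = inj₁ (siblings-apart w↑≡u↑ w<u)
  ... | tri≈ _ w≡u _ = ⊥-elim (w≢u w≡u)
  ... | tri> _ _ u<w = inj₂ (siblings-apart (sym w↑≡u↑) u<w)

  -- Children's intervals lie inside their parents', so disjointness passes
  -- down from parents to children.
  apart-children : ∀ {w u w′ u′} → par w ≡ just w′ → par u ≡ just u′ → Apart w′ u′ → Apart w u
  apart-children w↑ u↑ (inj₁ w′<u′) = inj₁ (≤-trans (<⇒≤ (child-end w↑)) (≤-trans w′<u′ (child-pos u↑)))
  apart-children w↑ u↑ (inj₂ u′<w′) = inj₂ (≤-trans (<⇒≤ (child-end u↑)) (≤-trans u′<w′ (child-pos w↑)))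

  same-depth-disjoint : ∀ {k w} → DepthAtMost par k w → ∀ u → depth w ≡ depth u → w ≢ u → Apart w u
  same-depth-disjoint {w = w} toRoot u dw≡du w≢u with par w ≟ᴹ par u
  ... | yes w↑≡u↑ = siblings-disjoint w↑≡u↑ w≢u
  ... | no  w↑≢u↑ = by-parents toRoot (par u) refl
    where
    by-parents : ∀ {k} → DepthAtMost par k w → ∀ x → par u ≡ x → Apart w u
    by-parents (root w↑)   nothing  u↑ = ⊥-elim (w↑≢u↑ (trans w↑ (sym u↑)))
    by-parents (root w↑)   (just _) u↑ = ⊥-elim (root-shallower w↑ u↑ dw≡du)
    by-parents (step w↑ _) nothing  u↑ = ⊥-elim (root-shallower u↑ w↑ (sym dw≡du))
    by-parents (step {v = w′} w↑ toRoot′) (just u′) u↑ =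
      apart-children w↑ u↑ (same-depth-disjoint toRoot′ u′ parents-same-depth parents-distinct)
      where
      parents-same-depth : depth w′ ≡ depth u′
      parents-same-depth = suc-injective (trans (sym (depth-child w↑)) (trans dw≡du (depth-child u↑)))
      parents-distinct : w′ ≢ u′
      parents-distinct w′≡u′ = w↑≢u↑ (trans w↑ (trans (cong just w′≡u′) (sym u↑)))

  info : Fin m → NodeInfo
  info u = depth u , pos u , len u

  parent⇒below : ∀ {u v} → par u ≡ just v → Below (info u) (info v)
  parent⇒below {u} u↑ = depth-child u↑ , child-pos u↑ , <-≤-trans (m<m+n (pos u) len-pos) (<⇒≤ (child-end u↑))
    where
    len-pos : 0 < len u
    len-pos = ≤-trans (s≤s z≤n) (len-lower u)

  -- The test is exact: if u lay below v without being its child, the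
  -- interval of u's actual parent and that of v would meet at pos u.
  below⇒parent : ∀ {u v} → Below (info u) (info v) → par u ≡ just v
  below⇒parent {u} {v} (du≡1+dv , pv≤pu , pu<end) with par u in u↑
  ... | nothing = ⊥-elim (depth≢0 v (suc-injective (trans (sym du≡1+dv) (depth-root u↑))))
  ... | just w with w ≟ v
  ...   | yes refl = refl
  ...   | no  w≢v = ⊥-elim (meet (same-depth-disjoint (depthOK F w) v w-depth w≢v))
    where
    w-depth : depth w ≡ depth v
    w-depth = suc-injective (trans (sym (depth-child u↑)) du≡1+dv)
    w-holds-u : pos w ≤ pos u × pos u < pos w + len w
    w-holds-u = proj₂ (parent⇒below u↑)
    meet : ¬ Apart w v
    meet (inj₁ w-before-v) = <-irrefl refl (<-≤-trans (proj₂ w-holds-u) (≤-trans w-before-v pv≤pu))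
    meet (inj₂ v-before-w) = <-irrefl refl (<-≤-trans pu<end (≤-trans v-before-w (proj₁ w-holds-u)))

  budget<d : ∀ v → suc (budget v) ≤ d
  budget<d v = begin
    suc (d ∸ depth v)  ≡⟨ +-∸-assoc 1 (depth-≤ v) ⟨
    suc d ∸ depth v    ≤⟨ ∸-monoʳ-≤ (suc d) (depth-pos v) ⟩
    d                  ∎
    where open ≤-Reasoning

  -- A slot costs at most (d + 2 (b + 1)) / d units per node of its subtree,
  -- where b is the budget: one unit for v itself and, per level, twice the
  -- slack of v, which is at most size v / d.
  slot-bound-at : ∀ k v → budget v ≡ k → d * slot v ≤ (d + 2 * suc k) * size v
  slot-bound-at k v b≡k = begin
    d * slot v                             ≡⟨ cong (d *_) (slot-eq v) ⟩
    d * (len v + slack v)                  ≤⟨ *-monoʳ-≤ d (+-monoˡ-≤ (slack v) (len-upper v)) ⟩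
    d * (suc S + slack v + slack v)        ≡⟨ expand d S (slack v) ⟩
    d + d * S + 2 * (d * slack v)          ≤⟨ +-mono-≤ (+-monoʳ-≤ d (children k b≡k)) (*-monoʳ-≤ 2 (slack-bound v)) ⟩
    d + (d + 2 * k) * s + 2 * size v       ≡⟨ cong (λ z → d + (d + 2 * k) * s + 2 * z) (size-eq v) ⟩
    d + (d + 2 * k) * s + 2 * suc s        ≤⟨ m≤m+n _ (2 * k) ⟩
    d + (d + 2 * k) * s + 2 * suc s + 2 * k ≡⟨ collect d k s ⟩
    (d + 2 * suc k) * suc s                ≡⟨ cong ((d + 2 * suc k) *_) (size-eq v) ⟨
    (d + 2 * suc k) * size v               ∎
    where
    open ≤-Reasoning
    S s : ℕ
    S = childSum v slot
    s = childSum v size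
    expand : ∀ d S x → d * (suc S + x + x) ≡ d + d * S + 2 * (d * x)
    expand = solve-∀
    collect : ∀ d k s → d + (d + 2 * k) * s + 2 * suc s + 2 * k ≡ (d + 2 * suc k) * suc s
    collect = solve-∀
    -- The children have budget k ∸ 1, so the claim for them is the
    -- induction hypothesis.
    children : ∀ k → budget v ≡ k → d * S ≤ (d + 2 * k) * s
    children zero    b≡0 = ≤-trans (≤-reflexive (trans (cong (d *_) (childSum-leaf v slot b≡0)) (*-zeroʳ d))) z≤n
    children (suc k) b≡  = begin
      d * S
        ≡⟨ *-sumUnder d (just v) slot ⟩
      childSum v (λ c → d * slot c)
        ≤⟨ sumUnder-mono (just v) (λ c c↑ → slot-bound-at k c (budget-child c↑ b≡)) ⟩
      childSum v (λ c → (d + 2 * suc k) * size c)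
        ≡⟨ *-sumUnder (d + 2 * suc k) (just v) size ⟨
      (d + 2 * suc k) * s ∎

  -- Since the budget is below d, every slot is at most three times the size.
  slot-bound : ∀ v → slot v ≤ 3 * size v
  slot-bound v = *-cancelˡ-≤ d (begin
    d * slot v                           ≤⟨ slot-bound-at (budget v) v refl ⟩
    (d + 2 * suc (budget v)) * size v    ≤⟨ *-monoˡ-≤ (size v) (+-monoʳ-≤ d (*-monoʳ-≤ 2 (budget<d v))) ⟩
    (d + 2 * d) * size v                 ≡⟨ regroup d (size v) ⟩
    d * (3 * size v)                     ∎)
    where
    open ≤-Reasoning
    regroup : ∀ d s → (d + 2 * d) * s ≡ d * (3 * s)
    regroup = solve-∀

  total-bound : total ≤ 3 * m
  total-bound = begin
    sumUnder nothing slot                   ≤⟨ sumUnder-mono nothing (λ c _ → slot-bound c) ⟩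
    sumUnder nothing (λ c → 3 * size c)     ≡⟨ *-sumUnder 3 nothing size ⟨
    3 * sumUnder nothing size               ≡⟨ cong (3 *_) roots-cover ⟩
    3 * m                                   ∎
    where open ≤-Reasoning

  -- The width field stays below 6 d, as 2 ^ align v > size v / (2 d).
  width-bound : ∀ v → width v < 6 * d
  width-bound v = *-cancelʳ-< (2 ^ align v) (width v) (6 * d) (begin-strict
    len v                        ≤⟨ m≤m+n (len v) (slack v) ⟩
    len v + slack v              ≡⟨ slot-eq v ⟨
    slot v                       ≤⟨ slot-bound v ⟩
    3 * size v                   <⟨ *-monoʳ-< 3 (size-bound v) ⟩
    3 * (2 ^ suc (align v) * d)  ≡⟨ regroup (2 ^ align v) d ⟩
    6 * d * 2 ^ align v          ∎)
    where
    open ≤-Reasoning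
    regroup : ∀ x d → 3 * (2 * x * d) ≡ 6 * d * x
    regroup = solve-∀

module Scheme (n d : ℕ) where

  open import Data.Nat
  open import Data.Nat.Properties
  open import Data.Bool using (true)
  open import Data.List using (_++_)
  open import Data.List.Properties using (length-++)
  open import Data.Product using (_×_; _,_)
  open import Data.Sum using (_⊎_)
  open import Data.Sum.Function.Propositional using (_⊎-⇔_)
  open import Data.Fin using (Fin)
  open import Data.Maybe using (just)
  open import Function.Bundles using (_⇔_; mk⇔)
  open import Function.Properties.Equivalence using () renaming (trans to ⇔-trans)
  open import Relation.Binary.PropositionalEquality
  open import Relation.Nullary using (Dec; yes; does)
  open import Relation.Nullary.Decidable using (_⊎-dec_; dec-true)
  open import Data.Nat.Tactic.RingSolver using (solve-∀)
  open FixedWidthCodes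
  open PowersOfTwo
  open Intervals

  -- Field widths: depths are ≤ d, widths < 6 d, and intervals lie in [0, 3 n).
  depthBits widthBits posBits : ℕ
  depthBits = suc (lg d)
  widthBits = suc (lg (6 * d))
  posBits   = suc (lg (3 * n))

  -- A label lists the depth δ and the width w in fixed width, then the
  -- index i of the interval's start i * 2 ^ t in posBits ∸ t bits, so that
  -- the label length reveals the alignment t.
  encode : (δ w i t : ℕ) → Label
  encode δ w i t = toBits depthBits δ ++ toBits widthBits w ++ toBits (posBits ∸ t) i

  decodeIndex : ℕ → ℕ → Label → NodeInfo
  decodeIndex δ w rest = δ , fromBits rest * 2 ^ t , w * 2 ^ t
    where
    t : ℕ
    t = posBits ∸ length rest

  decodeWidth : ℕ → ℕ × Label → NodeInfo
  decodeWidth δ (w , rest) = decodeIndex δ w rest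

  decodeDepth : ℕ × Label → NodeInfo
  decodeDepth (δ , rest) = decodeWidth δ (readBits widthBits rest)

  decode : Label → NodeInfo
  decode ℓ = decodeDepth (readBits depthBits ℓ)

  decode-encode : ∀ δ w i t → δ < 2 ^ depthBits → w < 2 ^ widthBits → i < 2 ^ (posBits ∸ t) → t ≤ posBits →
                  decode (encode δ w i t) ≡ (δ , i * 2 ^ t , w * 2 ^ t)
  decode-encode δ w i t δ< w< i< t≤ = begin
    decodeDepth (readBits depthBits (toBits depthBits δ ++ widthAndIndex))
      ≡⟨ cong decodeDepth (readBits-toBits depthBits δ widthAndIndex δ<) ⟩
    decodeWidth δ (readBits widthBits (toBits widthBits w ++ index))
      ≡⟨ cong (decodeWidth δ) (readBits-toBits widthBits w index w<) ⟩
    decodeIndex δ w index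
      ≡⟨ cong₂ (λ x s → δ , x * 2 ^ s , w * 2 ^ s) (fromBits-toBits (posBits ∸ t) i i<) alignment ⟩
    (δ , i * 2 ^ t , w * 2 ^ t) ∎
    where
    open ≡-Reasoning
    index widthAndIndex : Label
    index         = toBits (posBits ∸ t) i
    widthAndIndex = toBits widthBits w ++ index
    alignment : posBits ∸ length index ≡ t
    alignment = trans (cong (posBits ∸_) (length-toBits (posBits ∸ t) i)) (m∸[m∸n]≡n t≤)

  length-encode : ∀ δ w i t → length (encode δ w i t) ≡ depthBits + (widthBits + (posBits ∸ t))
  length-encode δ w i t = begin
    length (toBits depthBits δ ++ toBits widthBits w ++ toBits (posBits ∸ t) i)
      ≡⟨ length-++ (toBits depthBits δ) ⟩
    length (toBits depthBits δ) + length (toBits widthBits w ++ toBits (posBits ∸ t) i)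
      ≡⟨ cong₂ _+_ (length-toBits depthBits δ) (length-++ (toBits widthBits w)) ⟩
    depthBits + (length (toBits widthBits w) + length (toBits (posBits ∸ t) i))
      ≡⟨ cong (depthBits +_) (cong₂ _+_ (length-toBits widthBits w) (length-toBits (posBits ∸ t) i)) ⟩
    depthBits + (widthBits + (posBits ∸ t)) ∎
    where open ≡-Reasoning

  capacity : 1 ≤ n → 1 ≤ d → 2 ^ (depthBits + (widthBits + posBits)) ≤ 144 * (n * (d * d))
  capacity 1≤n 1≤d = begin
    2 ^ (depthBits + (widthBits + posBits))
      ≡⟨ trans (^-distribˡ-+-* 2 depthBits _) (cong (2 ^ depthBits *_) (^-distribˡ-+-* 2 widthBits posBits)) ⟩
    2 ^ depthBits * (2 ^ widthBits * 2 ^ posBits)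
      ≤⟨ *-mono-≤ (2^[1+lg]≤2* d 1≤d) (*-mono-≤ (2^[1+lg]≤2* (6 * d) (≤-trans 1≤d (m≤n*m d 6)))
                                                (2^[1+lg]≤2* (3 * n) (≤-trans 1≤n (m≤n*m n 3)))) ⟩
    2 * d * (2 * (6 * d) * (2 * (3 * n)))
      ≡⟨ collect d n ⟩
    144 * (n * (d * d)) ∎
    where
    open ≤-Reasoning
    collect : ∀ d n → 2 * d * (2 * (6 * d) * (2 * (3 * n))) ≡ 144 * (n * (d * d))
    collect = solve-∀

  does≡true⇔ : ∀ {A : Set} (A? : Dec A) → (does A? ≡ true) ⇔ A
  does≡true⇔ A? = mk⇔ (from A?) (dec-true A?)
    where
    from : ∀ {A : Set} (A? : Dec A) → does A? ≡ true → A
    from (yes a) _ = a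

  adjacency? : ∀ a b → Dec (Below (decode a) (decode b) ⊎ Below (decode b) (decode a))
  adjacency? a b = below? (decode a) (decode b) ⊎-dec below? (decode b) (decode a)

  adjacent? : Label → Label → Bool
  adjacent? a b = does (adjacency? a b)

  module Labels {m : ℕ} .{{_ : NonZero d}} (m≤n : m ≤ n) (F : Forest m d) where

    open Layout F

    label : Fin m → Label
    label u = encode (depth u) (width u) (index u) (align u)

    total<2^posBits : total < 2 ^ posBits
    total<2^posBits = ≤-<-trans total-bound (≤-<-trans (*-monoʳ-≤ 3 m≤n) (<2^[1+lg] (3 * n)))

    align<posBits : ∀ u → align u < posBits
    align<posBits u = 2^-cancel-< (begin-strict
      2 ^ align u      ≤⟨ 2^align≤len u ⟩
      len u            ≤⟨ m≤n+m (len u) (pos u) ⟩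
      pos u + len u    ≤⟨ end≤total u ⟩
      total            <⟨ total<2^posBits ⟩
      2 ^ posBits      ∎)
      where open ≤-Reasoning

    index-bound : ∀ u → index u < 2 ^ (posBits ∸ align u)
    index-bound u = *-cancelʳ-< (2 ^ align u) (index u) (2 ^ (posBits ∸ align u)) (begin-strict
      pos u                                   <⟨ m<m+n (pos u) (≤-trans (m^n>0 2 (align u)) (2^align≤len u)) ⟩
      pos u + len u                           ≤⟨ end≤total u ⟩
      total                                   <⟨ total<2^posBits ⟩
      2 ^ posBits                             ≡⟨ cong (2 ^_) (m∸n+n≡m (<⇒≤ (align<posBits u))) ⟨
      2 ^ (posBits ∸ align u + align u)       ≡⟨ ^-distribˡ-+-* 2 (posBits ∸ align u) (align u) ⟩
      2 ^ (posBits ∸ align u) * 2 ^ align u   ∎)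
      where open ≤-Reasoning

    decode-label : ∀ u → decode (label u) ≡ info u
    decode-label u = decode-encode (depth u) (width u) (index u) (align u)
      (≤-<-trans (depth-≤ u) (<2^[1+lg] d))
      (<-trans (width-bound u) (<2^[1+lg] (6 * d)))
      (index-bound u)
      (<⇒≤ (align<posBits u))

    below⇔parent : ∀ u v → Below (decode (label u)) (decode (label v)) ⇔ (parent F u ≡ just v)
    below⇔parent u v = subst₂ (λ a b → Below a b ⇔ (parent F u ≡ just v))
                              (sym (decode-label u)) (sym (decode-label v)) (mk⇔ below⇒parent parent⇒below)

    correct : ∀ u v → (adjacent? (label u) (label v) ≡ true) ⇔ Adjacent F u v
    correct u v = ⇔-trans (does≡true⇔ (adjacency? (label u) (label v))) (below⇔parent u v ⊎-⇔ below⇔parent v u)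

    label-size : 1 ≤ n → ∀ u → 2 ^ length (label u) ≤ 2 ^ 8 * n * d ^ 3
    label-size 1≤n u = begin
      2 ^ length (label u)
        ≡⟨ cong (2 ^_) (length-encode (depth u) (width u) (index u) (align u)) ⟩
      2 ^ (depthBits + (widthBits + (posBits ∸ align u)))
        ≤⟨ ^-monoʳ-≤ 2 (+-monoʳ-≤ depthBits (+-monoʳ-≤ widthBits (m∸n≤m posBits (align u)))) ⟩
      2 ^ (depthBits + (widthBits + posBits))             ≤⟨ capacity 1≤n (>-nonZero⁻¹ d) ⟩
      144 * (n * (d * d))                                 ≤⟨ *-mono-≤ (m≤m+n 144 112) (*-monoʳ-≤ n (m≤m*n (d * d) d)) ⟩
      256 * (n * (d * d * d))                             ≡⟨ regroup d n ⟩
      2 ^ 8 * n * d ^ 3                                   ∎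
      where
      open ≤-Reasoning
      regroup : ∀ d n → 256 * (n * (d * d * d)) ≡ 256 * n * (d * (d * (d * 1)))
      regroup = solve-∀

theorem2 : ∃[ C ] ∀ (n d : ℕ) → 1 ≤ n → 1 ≤ d →
    Σ (Label → Label → Bool) λ D →
      LabelingScheme n d D (λ ℓ → 2 ^ length ℓ ≤ 2 ^ C * n * d ^ 3)
theorem2 = 8 , λ n d 1≤n 1≤d → Scheme.adjacent? n d , λ m m≤n F →
  let open Scheme.Labels n d {{>-nonZero 1≤d}} m≤n F in label , label-size 1≤n , correct
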